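{- Let $r$ be a fraction lying at level $n$ of the Calkin–Wilf tree, and let $[a_0;a_1,a_2,\ldots,a_m]$ be a (finite simple) continued fraction representing $r$. Then $a_0+a_1+\cdots+a_m=n$.
   Context: The Calkin–Wilf tree is the rooted infinite binary tree whose vertices are labeled by fractions: the root is $\frac{1}{1}$, and a vertex labeled $\frac{a}{b}$ has left child $\frac{a}{a+b}$ and right child $\frac{a+b}{b}$. The root is at level $1$, and the children of a vertex at level $k$ are at level $k+1$. The notation $[a_0;a_1,\ldots,a_m]$ denotes the continued fraction $a_0+\cfrac{1}{a_1+\cfrac{1}{\ddots+\cfrac{1}{a_m}}}$, where $a_0$ is a nonnegative integer and $a_1,\ldots,a_m$ are positive integers (the representation of a rational is not unique, e.g. $[a_0;\ldots,a_m]=[a_0;\ldots,a_m-1,1]$ when $a_m>1$). -}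

module Defs where

open import Data.Nat using (ℕ; zero; suc; _+_; _*_; _<_)
open import Data.Product using (_×_; _,_; proj₁; proj₂)
open import Data.List using (List; []; _∷_)
open import Data.Nat.ListAction using (sum)
open import Data.List.Relation.Unary.All using (All)
open import Relation.Binary.PropositionalEquality using (_≡_)

-- Calkin–Wilf tree: `AtLevel n a b` means some vertex at level n of the
-- Calkin–Wilf tree carries the label a/b.
data AtLevel : ℕ → ℕ → ℕ → Set where
  root  : AtLevel 1 1 1
  left  : ∀ {n a b} → AtLevel n a b → AtLevel (suc n) a (a + b)
  right : ∀ {n a b} → AtLevel n a b → AtLevel (suc n) (a + b) b

-- Value of the continued fraction [a₀; a₁, …, aₘ] as a (numerator,
-- denominator) pair:  [a] = a/1,  [a; rest] = a + 1/[rest] = (a·p + q)/p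
-- where [rest] = p/q.
cfFrac : ℕ → List ℕ → ℕ × ℕ
cfFrac a []       = a , 1
cfFrac a (x ∷ xs) =
  a * proj₁ (cfFrac x xs) + proj₂ (cfFrac x xs) , proj₁ (cfFrac x xs)

Represents : ℕ → List ℕ → ℕ → ℕ → Set
Represents a₀ as a b =
  All (λ x → 0 < x) as × (proj₁ (cfFrac a₀ as) * b ≡ a * proj₂ (cfFrac a₀ as))

cfSum : ℕ → List ℕ → ℕ
cfSum a₀ as = a₀ + sum as

module Submission where

-- A vertex at level n of the Calkin–Wilf tree is reached from the root by
-- n − 1 left/right steps, and a continued fraction [a₀; a₁, …, aₘ] with
-- a₀ + ⋯ + aₘ = n describes such a path: a₀ right steps on top of the
-- mirror image of the path for [a₁; a₂, …, aₘ], and the chain of a₀ − 1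
-- right steps 1/1, 2/1, …, a₀/1 at the bottom of the recursion.  So the
-- proof has two halves.
--   (1) Existence: the value of [a₀; as] labels a vertex at level
--       a₀ + sum as (using that the tree is closed under a/b ↦ b/a and that
--       k right steps turn a/b into (a + k·b)/b).
--   (2) Uniqueness: two vertices carrying the same fraction (equal up to
--       cross-multiplication) are at the same level.  Left children are
--       below 1, right children above 1, the root equals 1, and a/b ↦ its
--       parent is determined by the fraction, so we descend simultaneously.
-- The theorem is (2) applied to the given vertex and the vertex from (1).

open import Defs
open import Data.Nat using (ℕ; zero; suc; _+_; _*_; _<_; z<s; >-nonZero)
open import Data.Nat.Properties
open import Data.List using (List; []; _∷_)
open import Data.List.Relation.Unary.All using (All; []; _∷_)
open import Data.Product using (_×_; _,_; proj₁; proj₂)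
open import Data.Empty using (⊥-elim)
open import Relation.Binary.PropositionalEquality

cross-invert : ∀ {a b c d} → a * d ≡ c * b → b * c ≡ d * a
cross-invert {a} {b} {c} {d} e = begin
  b * c ≡⟨ *-comm b c ⟩
  c * b ≡⟨ sym e ⟩
  a * d ≡⟨ *-comm a d ⟩
  d * a ∎
  where open ≡-Reasoning

cross-below-one : ∀ {a b c d} → 0 < d → a * d ≡ c * b → a < b → c < d
cross-below-one {a} {b} {c} {d} d>0 e a<b = ≰⇒> λ d≤c → <-irrefl e (begin-strict
  a * d <⟨ *-monoˡ-< d {{>-nonZero d>0}} a<b ⟩
  b * d ≤⟨ *-monoʳ-≤ b d≤c ⟩
  b * c ≡⟨ *-comm b c ⟩
  c * b ∎)
  where open ≤-Reasoning

cross-above-one : ∀ {a b c d} → 0 < c → a * d ≡ c * b → b < a → d < c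
cross-above-one {a} {b} {c} {d} c>0 e b<a =
  cross-below-one c>0 (cross-invert {a} {b} {c} {d} e) b<a

cross-cancel-left : ∀ {a b c d} → a * (c + d) ≡ c * (a + b) → a * d ≡ c * b
cross-cancel-left {a} {b} {c} {d} e = +-cancelˡ-≡ (a * c) (a * d) (c * b) (begin
  a * c + a * d ≡⟨ *-distribˡ-+ a c d ⟨
  a * (c + d)   ≡⟨ e ⟩
  c * (a + b)   ≡⟨ *-distribˡ-+ c a b ⟩
  c * a + c * b ≡⟨ cong (_+ c * b) (*-comm c a) ⟩
  a * c + c * b ∎)
  where open ≡-Reasoning

cross-cancel-right : ∀ {a b c d} → (a + b) * d ≡ (c + d) * b → a * d ≡ c * b
cross-cancel-right {a} {b} {c} {d} e = +-cancelʳ-≡ (b * d) (a * d) (c * b) (begin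
  a * d + b * d ≡⟨ *-distribʳ-+ d a b ⟨
  (a + b) * d   ≡⟨ e ⟩
  (c + d) * b   ≡⟨ *-distribʳ-+ b c d ⟩
  c * b + d * b ≡⟨ cong (c * b +_) (*-comm d b) ⟩
  c * b + b * d ∎)
  where open ≡-Reasoning

labels-positive : ∀ {n a b} → AtLevel n a b → 0 < a × 0 < b
labels-positive root = z<s , z<s
labels-positive (left t)  =
  let a>0 , b>0 = labels-positive t in a>0 , ≤-trans a>0 (m≤m+n _ _)
labels-positive (right t) =
  let a>0 , b>0 = labels-positive t in ≤-trans a>0 (m≤m+n _ _) , b>0

relabel : ∀ {n a b a′ b′} → a ≡ a′ → b ≡ b′ → AtLevel n a b → AtLevel n a′ b′
relabel = subst₂ (AtLevel _)

mirror : ∀ {n a b} → AtLevel n a b → AtLevel n b a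
mirror root      = root
mirror (left {a = a} {b} t)  = relabel (+-comm b a) refl (right (mirror t))
mirror (right {a = a} {b} t) = relabel refl (+-comm b a) (left (mirror t))

right-steps : ∀ k {n a b} → AtLevel n a b → AtLevel (k + n) (k * b + a) b
right-steps zero    t = t
right-steps (suc k) {a = a} {b} t =
  relabel (trans (+-comm (k * b + a) b) (sym (+-assoc b (k * b) a))) refl
    (right (right-steps k t))

integer-vertex : ∀ k → AtLevel (suc k) (suc k) 1
integer-vertex k =
  subst₂ (λ l x → AtLevel l x 1) (+-comm k 1)
    (trans (cong (_+ 1) (*-identityʳ k)) (+-comm k 1)) (right-steps k root)

numerator denominator : ℕ → List ℕ → ℕ
numerator   a₀ as = proj₁ (cfFrac a₀ as)
denominator a₀ as = proj₂ (cfFrac a₀ as)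

-- With all partial quotients positive, [x; xs] labels a vertex at level
-- x + sum xs: [x; y, ys] = x + 1/[y; ys] is x right steps below the mirror
-- image of [y; ys].
cf-at-level⁺ : ∀ x xs → 0 < x → All (0 <_) xs →
  AtLevel (cfSum x xs) (numerator x xs) (denominator x xs)
cf-at-level⁺ (suc k) []       _ _ =
  subst (λ l → AtLevel l (suc k) 1) (sym (+-identityʳ (suc k))) (integer-vertex k)
cf-at-level⁺ x       (y ∷ ys) _ (y>0 ∷ ys>0) =
  right-steps x (mirror (cf-at-level⁺ y ys y>0 ys>0))

cf-at-level : ∀ a₀ as → All (0 <_) as → 0 < numerator a₀ as →
  AtLevel (cfSum a₀ as) (numerator a₀ as) (denominator a₀ as)
cf-at-level a₀ []       _            a₀>0 = cf-at-level⁺ a₀ [] a₀>0 []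
cf-at-level a₀ (y ∷ ys) (y>0 ∷ ys>0) _    =
  right-steps a₀ (mirror (cf-at-level⁺ y ys y>0 ys>0))

numerator-positive : ∀ {a b} a₀ as → 0 < a → Represents a₀ as a b →
  0 < numerator a₀ as
numerator-positive zero    [] a>0 (_ , e) =
  ⊥-elim (<-irrefl (trans e (*-identityʳ _)) a>0)
numerator-positive (suc _) [] _   _       = z<s
numerator-positive a₀ (y ∷ ys) _ (y>0 ∷ ys>0 , _) =
  ≤-trans (proj₂ (labels-positive (cf-at-level⁺ y ys y>0 ys>0))) (m≤n+m _ _)

-- (2) The level of a vertex is determined by its fraction: the root is the
-- only vertex with value 1, left children lie below 1, right children above
-- 1, and equal children have equal parents.
level-determined : ∀ {n a b m c d} → AtLevel n a b → AtLevel m c d →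
  a * d ≡ c * b → n ≡ m
level-determined root root _ = refl
level-determined root (left q) e =
  ⊥-elim (n≮n 1 (cross-below-one z<s (sym e) (m<m+n _ (proj₂ (labels-positive q)))))
level-determined root (right q) e =
  ⊥-elim (n≮n 1 (cross-above-one z<s (sym e) (m<n+m _ (proj₁ (labels-positive q)))))
level-determined (left p) root e =
  ⊥-elim (n≮n 1 (cross-below-one z<s e (m<m+n _ (proj₂ (labels-positive p)))))
level-determined (right p) root e =
  ⊥-elim (n≮n 1 (cross-above-one z<s e (m<n+m _ (proj₁ (labels-positive p)))))
level-determined (left {a = a} {b} p) (left {a = c} {d} q) e =
  cong suc (level-determined p q (cross-cancel-left {a} {b} {c} {d} e))
level-determined (right {a = a} {b} p) (right {a = c} {d} q) e =
  cong suc (level-determined p q (cross-cancel-right {a} {b} {c} {d} e))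
level-determined (left {a = a} {b} p) (right {a = c} {d} q) e =
  ⊥-elim (m+n≮n c d (cross-below-one (proj₂ (labels-positive q)) e
    (m<m+n _ (proj₂ (labels-positive p)))))
level-determined (right {a = a} {b} p) (left {a = c} {d} q) e =
  ⊥-elim (m+n≮m c d (cross-above-one (proj₁ (labels-positive q)) e
    (m<n+m _ (proj₁ (labels-positive p)))))

mainTheorem1 : (n a b : ℕ) → AtLevel n a b →
    (a₀ : ℕ) (as : List ℕ) → Represents a₀ as a b → cfSum a₀ as ≡ n
mainTheorem1 n a b t a₀ as (as>0 , e) =
  sym (level-determined t (cf-at-level a₀ as as>0 value>0) (sym e))
  where
  value>0 : 0 < numerator a₀ as
  value>0 = numerator-positive a₀ as (proj₁ (labels-positive t)) (as>0 , e)
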